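{- Let $n \ge 3$ be an integer and let $A^{(n)}$ be the $n\times n$ real matrix with entries $$A^{(n)}_{ij} = \begin{cases} 1, & \text{if } -2 \le j-i \le 1,\\ 1, & \text{if } (i,j)=(1,n),\\ 0, & \text{otherwise},\end{cases}$$ and let $A_n=\det A^{(n)}$. Then $$A_n=\begin{cases} 1, & n\equiv 0 \pmod 4,\\ 2, & n\equiv 1 \pmod 4,\\ -1, & n\equiv 2 \pmod 4,\\ 0, & n\equiv 3 \pmod 4.\end{cases}$$
   Context: $A^{(n)}$ is the Toeplitz matrix whose first superdiagonal, main diagonal and first two subdiagonals consist of ones, with an additional entry $1$ in the top-right corner $(1,n)$, and zeros elsewhere. -}

module Defs where

open import Data.Nat as ℕ using (ℕ; zero; suc)
open import Data.Integer using (ℤ; +_; -_; _+_; _*_)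
open import Data.Fin using (Fin; zero; suc; toℕ; punchIn)
open import Data.Bool using (Bool; true; false; if_then_else_; _∨_; _∧_)
open import Data.Nat using (_≤ᵇ_; _≡ᵇ_)

Matrix : ℕ → Set
Matrix n = Fin n → Fin n → ℤ

∑ : ∀ {n} → (Fin n → ℤ) → ℤ
∑ {zero}  f = + 0
∑ {suc n} f = f zero + ∑ (λ i → f (suc i))

sgn : ℕ → ℤ
sgn zero = + 1
sgn (suc k) = - sgn k

det : ∀ {n} → Matrix n → ℤ
det {zero}  M = + 1
det {suc n} M =
  ∑ (λ j → sgn (toℕ j) * (M zero j * det (λ i k → M (suc i) (punchIn j k))))

-- The matrix A^(n), 1-based indices i = toℕ r + 1, j = toℕ c + 1:
-- entry 1 iff -2 ≤ j - i ≤ 1 (i.e. j ≤ i + 1 and i ≤ j + 2), or (i,j) = (1,n).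
A : (n : ℕ) → Matrix n
A n r c =
  if ((toℕ c ≤ᵇ suc (toℕ r)) ∧ (toℕ r ≤ᵇ toℕ c ℕ.+ 2))
     ∨ ((toℕ r ≡ᵇ 0) ∧ (suc (toℕ c) ≡ᵇ n))
  then + 1 else + 0

module Submission where

open import Defs
open import Data.Nat using (ℕ; _≤_; _%_)
open import Data.Integer using (ℤ; +_; -_)
open import Relation.Binary.PropositionalEquality using (_≡_)
open import Data.Product using (_×_)

open import Data.Nat as ℕ using (zero; suc; _≤ᵇ_; _≡ᵇ_; s≤s)
open import Data.Nat.Properties using (≡⇒≡ᵇ; +-comm)
open import Data.Nat.DivMod using ([m+n]%n≡m%n)
open import Data.Integer using (_+_; _*_; _-_)
open import Data.Integer.Properties using (*-zeroʳ; +-identityˡ; +-identityʳ; neg-involutive)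
open import Data.Integer.Tactic.RingSolver using (solve-∀)
open import Data.Fin using (Fin; zero; suc; toℕ; punchIn; punchOut; fromℕ; inject₁; _≟_)
open import Data.Fin.Properties using (toℕ-fromℕ; punchIn-punchOut)
open import Data.Bool using (Bool; false; if_then_else_; _∧_)
open import Data.Bool.Properties using (∨-identityʳ; T-≡)
open import Data.Product using (_,_)
open import Function.Bundles using (Equivalence)
open import Relation.Binary.PropositionalEquality using (refl; sym; trans; cong; cong₂; module ≡-Reasoning)
open import Relation.Nullary using (yes; no)

-- Expanding det A⁽ⁿ⁾ along its first row, which is (1, 1, 0, …, 0, 1),
-- leaves three minors: the plain band matrix T, the band with its second column
-- deleted (T∖1), and the band shifted one step to the right (U).  Expanding these
-- along their first rows in turn produces only finitely many shapes of matrices,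
-- six families in all (T, T∖1, T∖12, U, U∖1, U∖2), each of whose first rows is
-- (1, 1, 0, …, 0) or (1, 1, 1, 0, …, 0), and whose minors are again members of the
-- families or have a zero column.  Hence their determinants satisfy a closed system
-- of linear recurrences, whose solutions are 4-periodic sequences; the recurrences
-- are identities between periodic sequences and are checked on one period.

∑-cong : ∀ {n} {f g : Fin n → ℤ} → (∀ i → f i ≡ g i) → ∑ f ≡ ∑ g
∑-cong {zero}  e = refl
∑-cong {suc n} e = cong₂ _+_ (e zero) (∑-cong (λ i → e (suc i)))

∑-zero : ∀ {n} {f : Fin n → ℤ} → (∀ i → f i ≡ + 0) → ∑ f ≡ + 0
∑-zero {zero}  e = refl
∑-zero {suc n} e = cong₂ _+_ (e zero) (∑-zero (λ i → e (suc i)))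

∑-last : ∀ {n} (f : Fin (suc n) → ℤ) → (∀ i → f (inject₁ i) ≡ + 0) → ∑ f ≡ f (fromℕ n)
∑-last {zero}  f e = +-identityʳ (f zero)
∑-last {suc n} f e =
  trans (cong₂ _+_ (e zero) (∑-last (λ i → f (suc i)) (λ i → e (suc i)))) (+-identityˡ _)

minor : ∀ {n} → Matrix (suc n) → Fin (suc n) → Matrix n
minor M j i k = M (suc i) (punchIn j k)

-- The j-th term of the Laplace expansion of det M along its first row,
-- so that  det M = ∑ (cofactor-term M)  holds by definition.
cofactor-term : ∀ {n} → Matrix (suc n) → Fin (suc n) → ℤ
cofactor-term M j = sgn (toℕ j) * (M zero j * det (minor M j))

term-vanishes : ∀ {n} (M : Matrix (suc n)) j → M zero j ≡ + 0 → cofactor-term M j ≡ + 0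
term-vanishes M j e =
  trans (cong (λ a → sgn (toℕ j) * (a * det (minor M j))) e) (*-zeroʳ (sgn (toℕ j)))

det-cong : ∀ {n} (M N : Matrix n) → (∀ i j → M i j ≡ N i j) → det M ≡ det N
det-cong {zero}  M N e = refl
det-cong {suc n} M N e = ∑-cong λ j →
  cong₂ (λ a d → sgn (toℕ j) * (a * d)) (e zero j)
        (det-cong (minor M j) (minor N j) (λ i k → e (suc i) (punchIn j k)))

-- A matrix with a zero column has determinant zero: the term of the expansion at
-- that column vanishes, and every other minor still contains the zero column.
det-zero-column : ∀ {n} (M : Matrix n) (p : Fin n) → (∀ r → M r p ≡ + 0) → det M ≡ + 0
det-zero-column {suc n} M p z = ∑-zero term
  where
  term : ∀ j → cofactor-term M j ≡ + 0
  term j with j ≟ p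
  ... | yes refl = term-vanishes M j (z zero)
  ... | no j≢p   = trans (cong (λ d → sgn (toℕ j) * (M zero j * d)) minor-vanishes)
                         (trans (cong (sgn (toℕ j) *_) (*-zeroʳ (M zero j))) (*-zeroʳ (sgn (toℕ j))))
    where
    minor-vanishes : det (minor M j) ≡ + 0
    minor-vanishes = det-zero-column (minor M j) (punchOut j≢p)
      (λ r → trans (cong (M (suc r)) (punchIn-punchOut j≢p)) (z (suc r)))

simplify-110 : ∀ x y → + 1 * (+ 1 * x) + (- + 1 * (+ 1 * y) + + 0) ≡ x - y
simplify-110 = solve-∀

simplify-111 : ∀ x y z →
  + 1 * (+ 1 * x) + (- + 1 * (+ 1 * y) + (+ 1 * (+ 1 * z) + + 0)) ≡ x - y + z
simplify-111 = solve-∀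

simplify-corner : ∀ x y s w → + 1 * (+ 1 * x) + (- + 1 * (+ 1 * y) + s * (+ 1 * w)) ≡ x - y + s * w
simplify-corner = solve-∀

expand-row-110 : ∀ {m} (M : Matrix (suc (suc m))) →
  M zero zero ≡ + 1 → M zero (suc zero) ≡ + 1 → (∀ j → M zero (suc (suc j)) ≡ + 0) →
  det M ≡ det (minor M zero) - det (minor M (suc zero))
expand-row-110 M e₀ e₁ z = begin
    cofactor-term M zero + (cofactor-term M (suc zero) + ∑ (λ j → cofactor-term M (suc (suc j))))
  ≡⟨ cong (λ s → cofactor-term M zero + (cofactor-term M (suc zero) + s))
          (∑-zero (λ j → term-vanishes M (suc (suc j)) (z j))) ⟩
    cofactor-term M zero + (cofactor-term M (suc zero) + + 0)
  ≡⟨ cong₂ (λ a b → + 1 * (a * d₀) + (- + 1 * (b * d₁) + + 0)) e₀ e₁ ⟩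
    + 1 * (+ 1 * d₀) + (- + 1 * (+ 1 * d₁) + + 0)
  ≡⟨ simplify-110 d₀ d₁ ⟩
    d₀ - d₁ ∎
  where
  open ≡-Reasoning
  d₀ : ℤ
  d₀ = det (minor M zero)
  d₁ : ℤ
  d₁ = det (minor M (suc zero))

expand-row-111 : ∀ {m} (M : Matrix (suc (suc (suc m)))) →
  M zero zero ≡ + 1 → M zero (suc zero) ≡ + 1 → M zero (suc (suc zero)) ≡ + 1 →
  (∀ j → M zero (suc (suc (suc j))) ≡ + 0) →
  det M ≡ det (minor M zero) - det (minor M (suc zero)) + det (minor M (suc (suc zero)))
expand-row-111 M e₀ e₁ e₂ z = begin
    cofactor-term M zero + (cofactor-term M (suc zero) + (cofactor-term M (suc (suc zero))
      + ∑ (λ j → cofactor-term M (suc (suc (suc j))))))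
  ≡⟨ cong (λ s → cofactor-term M zero + (cofactor-term M (suc zero) + (cofactor-term M (suc (suc zero)) + s)))
          (∑-zero (λ j → term-vanishes M (suc (suc (suc j))) (z j))) ⟩
    cofactor-term M zero + (cofactor-term M (suc zero) + (cofactor-term M (suc (suc zero)) + + 0))
  ≡⟨ cong₂ (λ a b → + 1 * (a * d₀) + (- + 1 * (b * d₁) + (+ 1 * (M zero (suc (suc zero)) * d₂) + + 0))) e₀ e₁ ⟩
    + 1 * (+ 1 * d₀) + (- + 1 * (+ 1 * d₁) + (+ 1 * (M zero (suc (suc zero)) * d₂) + + 0))
  ≡⟨ cong (λ c → + 1 * (+ 1 * d₀) + (- + 1 * (+ 1 * d₁) + (+ 1 * (c * d₂) + + 0))) e₂ ⟩
    + 1 * (+ 1 * d₀) + (- + 1 * (+ 1 * d₁) + (+ 1 * (+ 1 * d₂) + + 0))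
  ≡⟨ simplify-111 d₀ d₁ d₂ ⟩
    d₀ - d₁ + d₂ ∎
  where
  open ≡-Reasoning
  d₀ : ℤ
  d₀ = det (minor M zero)
  d₁ : ℤ
  d₁ = det (minor M (suc zero))
  d₂ : ℤ
  d₂ = det (minor M (suc (suc zero)))

expand-row-corner : ∀ {k} (M : Matrix (suc (suc (suc k)))) →
  M zero zero ≡ + 1 → M zero (suc zero) ≡ + 1 →
  (∀ i → M zero (suc (suc (inject₁ i))) ≡ + 0) → M zero (fromℕ (suc (suc k))) ≡ + 1 →
  det M ≡ det (minor M zero) - det (minor M (suc zero))
          + sgn (suc (suc k)) * det (minor M (fromℕ (suc (suc k))))
expand-row-corner {k} M e₀ e₁ z eₗ = begin
    cofactor-term M zero + (cofactor-term M (suc zero) + ∑ (λ j → cofactor-term M (suc (suc j))))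
  ≡⟨ cong (λ s → cofactor-term M zero + (cofactor-term M (suc zero) + s))
          (∑-last (λ j → cofactor-term M (suc (suc j))) (λ i → term-vanishes M (suc (suc (inject₁ i))) (z i))) ⟩
    cofactor-term M zero + (cofactor-term M (suc zero) + cofactor-term M last)
  ≡⟨ cong₂ (λ a b → + 1 * (a * d₀) + (- + 1 * (b * d₁) + cofactor-term M last)) e₀ e₁ ⟩
    + 1 * (+ 1 * d₀) + (- + 1 * (+ 1 * d₁) + cofactor-term M last)
  ≡⟨ cong (λ t → + 1 * (+ 1 * d₀) + (- + 1 * (+ 1 * d₁) + t))
          (cong₂ (λ s c → s * (c * dₗ)) (cong sgn (toℕ-fromℕ (suc (suc k)))) eₗ) ⟩
    + 1 * (+ 1 * d₀) + (- + 1 * (+ 1 * d₁) + sgn (suc (suc k)) * (+ 1 * dₗ))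
  ≡⟨ simplify-corner d₀ d₁ (sgn (suc (suc k))) dₗ ⟩
    d₀ - d₁ + sgn (suc (suc k)) * dₗ ∎
  where
  open ≡-Reasoning
  last : Fin (suc (suc (suc k)))
  last = fromℕ (suc (suc k))
  d₀ : ℤ
  d₀ = det (minor M zero)
  d₁ : ℤ
  d₁ = det (minor M (suc zero))
  dₗ : ℤ
  dₗ = det (minor M last)

inBand : ℕ → ℕ → Bool
inBand i j = (j ≤ᵇ suc i) ∧ (i ≤ᵇ j ℕ.+ 2)

band : ℕ → ℕ → ℤ
band i j = if inBand i j then + 1 else + 0

band-shift : ∀ i j → band (suc i) (suc j) ≡ band i j
band-shift zero    zero    = refl
band-shift zero    (suc j) = refl
band-shift (suc i) zero    = refl
band-shift (suc i) (suc j) = refl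

-- Column maps of iterated minors: skip₁ omits column 1, skip₁₂ omits columns 1
-- and 2, skip₂ omits column 2.
skip₁ skip₁₂ skip₂ : ℕ → ℕ
skip₁ zero = zero
skip₁ (suc c) = suc (suc c)
skip₁₂ zero = zero
skip₁₂ (suc c) = suc (suc (suc c))
skip₂ zero = zero
skip₂ (suc zero) = suc zero
skip₂ (suc (suc c)) = suc (suc (suc c))

-- T is the band
-- itself and U the band shifted one column to the right; the others are obtained
-- by shifting the rows down and deleting the columns indicated by their names.
T T∖1 T∖12 U U∖1 U∖2 : (m : ℕ) → Matrix m
T    m r c = band (toℕ r) (toℕ c)
T∖1  m r c = band (suc (toℕ r)) (skip₁ (toℕ c))
T∖12 m r c = band (suc (suc (toℕ r))) (skip₁₂ (toℕ c))
U    m r c = band (suc (toℕ r)) (toℕ c)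
U∖1  m r c = band (suc (suc (toℕ r))) (skip₁ (toℕ c))
U∖2  m r c = band (suc (suc (toℕ r))) (skip₂ (toℕ c))

T-minor₀ : ∀ m → det (minor (T (suc m)) zero) ≡ det (T m)
T-minor₀ m = det-cong _ (T m) (λ i k → band-shift (toℕ i) (toℕ k))

T-minor₁ : ∀ m → det (minor (T (suc (suc m))) (suc zero)) ≡ det (T∖1 (suc m))
T-minor₁ m = det-cong _ (T∖1 (suc m)) entries
  where
  entries : ∀ i k → minor (T (suc (suc m))) (suc zero) i k ≡ T∖1 (suc m) i k
  entries i zero    = refl
  entries i (suc k) = refl

T∖1-minor₀ : ∀ m → det (minor (T∖1 (suc m)) zero) ≡ det (T m)
T∖1-minor₀ m = det-cong _ (T m)
  (λ i k → trans (band-shift (suc (toℕ i)) (suc (toℕ k))) (band-shift (toℕ i) (toℕ k)))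

T∖1-minor₁ : ∀ m → det (minor (T∖1 (suc (suc m))) (suc zero)) ≡ det (T∖12 (suc m))
T∖1-minor₁ m = det-cong _ (T∖12 (suc m)) entries
  where
  entries : ∀ i k → minor (T∖1 (suc (suc m))) (suc zero) i k ≡ T∖12 (suc m) i k
  entries i zero    = refl
  entries i (suc k) = refl

T∖12-minor₀ : ∀ m → det (minor (T∖12 (suc m)) zero) ≡ det (T m)
T∖12-minor₀ m = det-cong _ (T m) (λ i k →
  trans (band-shift (suc (suc (toℕ i))) (suc (suc (toℕ k))))
        (trans (band-shift (suc (toℕ i)) (suc (toℕ k))) (band-shift (toℕ i) (toℕ k))))

T∖12-minor₁ : ∀ m → det (minor (T∖12 (suc (suc m))) (suc zero)) ≡ + 0
T∖12-minor₁ m = det-zero-column (minor (T∖12 (suc (suc m))) (suc zero)) zero (λ r → refl)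

U-minor₀ : ∀ m → det (minor (U (suc m)) zero) ≡ det (U m)
U-minor₀ m = det-cong _ (U m) (λ i k → band-shift (suc (toℕ i)) (toℕ k))

U-minor₁ : ∀ m → det (minor (U (suc (suc m))) (suc zero)) ≡ det (U∖1 (suc m))
U-minor₁ m = det-cong _ (U∖1 (suc m)) entries
  where
  entries : ∀ i k → minor (U (suc (suc m))) (suc zero) i k ≡ U∖1 (suc m) i k
  entries i zero    = refl
  entries i (suc k) = refl

U-minor₂ : ∀ m → det (minor (U (suc (suc (suc m)))) (suc (suc zero))) ≡ det (U∖2 (suc (suc m)))
U-minor₂ m = det-cong _ (U∖2 (suc (suc m))) entries
  where
  entries : ∀ i k → minor (U (suc (suc (suc m)))) (suc (suc zero)) i k ≡ U∖2 (suc (suc m)) i k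
  entries i zero          = refl
  entries i (suc zero)    = refl
  entries i (suc (suc k)) = refl

U∖1-minor₀ : ∀ m → det (minor (U∖1 (suc m)) zero) ≡ det (U m)
U∖1-minor₀ m = det-cong _ (U m)
  (λ i k → trans (band-shift (suc (suc (toℕ i))) (suc (toℕ k))) (band-shift (suc (toℕ i)) (toℕ k)))

U∖2-minor₀ : ∀ m → det (minor (U∖2 (suc m)) zero) ≡ det (U∖1 m)
U∖2-minor₀ m = det-cong _ (U∖1 m) entries
  where
  entries : ∀ i k → minor (U∖2 (suc m)) zero i k ≡ U∖1 m i k
  entries i zero    = band-shift (suc (suc (toℕ i))) zero
  entries i (suc k) = band-shift (suc (suc (toℕ i))) (suc (suc (toℕ k)))

U∖1-minor₁ : ∀ m → det (minor (U∖1 (suc (suc m))) (suc zero)) ≡ + 0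
U∖1-minor₁ m = det-zero-column (minor (U∖1 (suc (suc m))) (suc zero)) zero (λ r → refl)

U∖1-minor₂ : ∀ m → det (minor (U∖1 (suc (suc (suc m)))) (suc (suc zero))) ≡ + 0
U∖1-minor₂ m = det-zero-column (minor (U∖1 (suc (suc (suc m)))) (suc (suc zero))) zero (λ r → refl)

U∖2-minor₁ : ∀ m → det (minor (U∖2 (suc (suc m))) (suc zero)) ≡ + 0
U∖2-minor₁ m = det-zero-column (minor (U∖2 (suc (suc m))) (suc zero)) zero (λ r → refl)

U∖2-minor₂ : ∀ m → det (minor (U∖2 (suc (suc (suc m)))) (suc (suc zero))) ≡ + 0
U∖2-minor₂ m = det-zero-column (minor (U∖2 (suc (suc (suc m)))) (suc (suc zero))) zero (λ r → refl)

periodic : ℤ → ℤ → ℤ → ℤ → ℕ → ℤ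
periodic a b c d zero = a
periodic a b c d (suc zero) = b
periodic a b c d (suc (suc zero)) = c
periodic a b c d (suc (suc (suc zero))) = d
periodic a b c d (suc (suc (suc (suc n)))) = periodic a b c d n

-- Induction along residues mod 4: P holds everywhere if it holds below 4 and
-- passes from n to n + 4.  Identities between periodic sequences need only be
-- checked on one period, with the step being the identity.
mod4-induction : (P : ℕ → Set) → P 0 → P 1 → P 2 → P 3 →
  (∀ n → P n → P (suc (suc (suc (suc n))))) → ∀ n → P n
mod4-induction P p₀ p₁ p₂ p₃ step zero = p₀
mod4-induction P p₀ p₁ p₂ p₃ step (suc zero) = p₁
mod4-induction P p₀ p₁ p₂ p₃ step (suc (suc zero)) = p₂
mod4-induction P p₀ p₁ p₂ p₃ step (suc (suc (suc zero))) = p₃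
mod4-induction P p₀ p₁ p₂ p₃ step (suc (suc (suc (suc n)))) =
  step n (mod4-induction P p₀ p₁ p₂ p₃ step n)

periodic-mod : ∀ a b c d n → periodic a b c d n ≡ periodic a b c d (n % 4)
periodic-mod a b c d = mod4-induction _ refl refl refl refl
  (λ n e → trans e (cong (periodic a b c d) (sym (%4-step n))))
  where
  %4-step : ∀ n → suc (suc (suc (suc n))) % 4 ≡ n % 4
  %4-step n = trans (cong (_% 4) (+-comm 4 n)) ([m+n]%n≡m%n n 4)

-- The determinants of the families at size 2 + m (det U and det U∖1 coincide
-- with det T and det T∖12).
dT dT∖1 dT∖12 dU∖2 : ℕ → ℤ
dT    = periodic (+ 0) (+ 0) (+ 1) (+ 1)
dT∖1  = periodic (+ 0) (- + 1) (+ 0) (+ 1)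
dT∖12 = periodic (+ 1) (+ 0) (+ 0) (+ 1)
dU∖2  = periodic (+ 1) (+ 1) (+ 0) (+ 0)

recurrence-T : ∀ m → dT m - dT∖1 m ≡ dT (suc m)
recurrence-T = mod4-induction _ refl refl refl refl (λ _ e → e)

recurrence-T∖1 : ∀ m → dT m - dT∖12 m ≡ dT∖1 (suc m)
recurrence-T∖1 = mod4-induction _ refl refl refl refl (λ _ e → e)

recurrence-T∖12 : ∀ m → dT m - + 0 ≡ dT∖12 (suc m)
recurrence-T∖12 = mod4-induction _ refl refl refl refl (λ _ e → e)

recurrence-U : ∀ m → dT m - dT∖12 m + dU∖2 m ≡ dT (suc m)
recurrence-U = mod4-induction _ refl refl refl refl (λ _ e → e)

recurrence-U∖1 : ∀ m → dT m - + 0 + + 0 ≡ dT∖12 (suc m)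
recurrence-U∖1 = mod4-induction _ refl refl refl refl (λ _ e → e)

recurrence-U∖2 : ∀ m → dT∖12 m - + 0 + + 0 ≡ dU∖2 (suc m)
recurrence-U∖2 = mod4-induction _ refl refl refl refl (λ _ e → e)

mutual
  det-T : ∀ m → det (T (suc (suc m))) ≡ dT m
  det-T zero    = refl
  det-T (suc m) = begin
      det M
    ≡⟨ expand-row-110 M refl refl (λ _ → refl) ⟩
      det (minor M zero) - det (minor M (suc zero))
    ≡⟨ cong₂ _-_ (trans (T-minor₀ (suc (suc m))) (det-T m)) (trans (T-minor₁ (suc m)) (det-T∖1 m)) ⟩
      dT m - dT∖1 m
    ≡⟨ recurrence-T m ⟩
      dT (suc m) ∎
    where
    open ≡-Reasoning
    M : Matrix (suc (suc (suc m)))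
    M = T (suc (suc (suc m)))

  det-T∖1 : ∀ m → det (T∖1 (suc (suc m))) ≡ dT∖1 m
  det-T∖1 zero    = refl
  det-T∖1 (suc m) = begin
      det M
    ≡⟨ expand-row-110 M refl refl (λ _ → refl) ⟩
      det (minor M zero) - det (minor M (suc zero))
    ≡⟨ cong₂ _-_ (trans (T∖1-minor₀ (suc (suc m))) (det-T m)) (trans (T∖1-minor₁ (suc m)) (det-T∖12 m)) ⟩
      dT m - dT∖12 m
    ≡⟨ recurrence-T∖1 m ⟩
      dT∖1 (suc m) ∎
    where
    open ≡-Reasoning
    M : Matrix (suc (suc (suc m)))
    M = T∖1 (suc (suc (suc m)))

  det-T∖12 : ∀ m → det (T∖12 (suc (suc m))) ≡ dT∖12 m
  det-T∖12 zero    = refl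
  det-T∖12 (suc m) = begin
      det M
    ≡⟨ expand-row-110 M refl refl (λ _ → refl) ⟩
      det (minor M zero) - det (minor M (suc zero))
    ≡⟨ cong₂ _-_ (trans (T∖12-minor₀ (suc (suc m))) (det-T m)) (T∖12-minor₁ (suc m)) ⟩
      dT m - + 0
    ≡⟨ recurrence-T∖12 m ⟩
      dT∖12 (suc m) ∎
    where
    open ≡-Reasoning
    M : Matrix (suc (suc (suc m)))
    M = T∖12 (suc (suc (suc m)))

mutual
  det-U : ∀ m → det (U (suc (suc m))) ≡ dT m
  det-U zero    = refl
  det-U (suc m) = begin
      det M
    ≡⟨ expand-row-111 M refl refl refl (λ _ → refl) ⟩
      det (minor M zero) - det (minor M (suc zero)) + det (minor M (suc (suc zero)))
    ≡⟨ cong₂ _+_ (cong₂ _-_ (trans (U-minor₀ (suc (suc m))) (det-U m)) (trans (U-minor₁ (suc m)) (det-U∖1 m)))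
                 (trans (U-minor₂ m) (det-U∖2 m)) ⟩
      dT m - dT∖12 m + dU∖2 m
    ≡⟨ recurrence-U m ⟩
      dT (suc m) ∎
    where
    open ≡-Reasoning
    M : Matrix (suc (suc (suc m)))
    M = U (suc (suc (suc m)))

  det-U∖1 : ∀ m → det (U∖1 (suc (suc m))) ≡ dT∖12 m
  det-U∖1 zero    = refl
  det-U∖1 (suc m) = begin
      det M
    ≡⟨ expand-row-111 M refl refl refl (λ _ → refl) ⟩
      det (minor M zero) - det (minor M (suc zero)) + det (minor M (suc (suc zero)))
    ≡⟨ cong₂ _+_ (cong₂ _-_ (trans (U∖1-minor₀ (suc (suc m))) (det-U m)) (U∖1-minor₁ (suc m)))
                 (U∖1-minor₂ m) ⟩
      dT m - + 0 + + 0
    ≡⟨ recurrence-U∖1 m ⟩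
      dT∖12 (suc m) ∎
    where
    open ≡-Reasoning
    M : Matrix (suc (suc (suc m)))
    M = U∖1 (suc (suc (suc m)))

  det-U∖2 : ∀ m → det (U∖2 (suc (suc m))) ≡ dU∖2 m
  det-U∖2 zero    = refl
  det-U∖2 (suc m) = begin
      det M
    ≡⟨ expand-row-111 M refl refl refl (λ _ → refl) ⟩
      det (minor M zero) - det (minor M (suc zero)) + det (minor M (suc (suc zero)))
    ≡⟨ cong₂ _+_ (cong₂ _-_ (trans (U∖2-minor₀ (suc (suc m))) (det-U∖1 m)) (U∖2-minor₁ (suc m)))
                 (U∖2-minor₂ m) ⟩
      dT∖12 m - + 0 + + 0
    ≡⟨ recurrence-U∖2 m ⟩
      dU∖2 (suc m) ∎
    where
    open ≡-Reasoning
    M : Matrix (suc (suc (suc m)))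
    M = U∖2 (suc (suc (suc m)))

A-below-first-row : ∀ n (r : Fin n) (c : Fin (suc n)) → A (suc n) (suc r) c ≡ band (suc (toℕ r)) (toℕ c)
A-below-first-row n r c =
  cong (λ b → if b then + 1 else + 0) (∨-identityʳ (inBand (suc (toℕ r)) (toℕ c)))

inject₁-not-last : ∀ {k} (i : Fin k) → (toℕ (inject₁ i) ≡ᵇ k) ≡ false
inject₁-not-last {suc k} zero    = refl
inject₁-not-last {suc k} (suc i) = inject₁-not-last i

A-first-row-middle : ∀ k (i : Fin k) → A (suc (suc (suc k))) zero (suc (suc (inject₁ i))) ≡ + 0
A-first-row-middle k i = cong (λ b → if b then + 1 else + 0) (inject₁-not-last i)

A-corner : ∀ k → A (suc (suc (suc k))) zero (fromℕ (suc (suc k))) ≡ + 1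
A-corner k = cong (λ b → if b then + 1 else + 0)
  (trans (cong (_≡ᵇ k) (toℕ-fromℕ k)) (Equivalence.to T-≡ (≡⇒≡ᵇ k k refl)))

toℕ-punchIn-last : ∀ {n} (k : Fin n) → toℕ (punchIn (fromℕ n) k) ≡ toℕ k
toℕ-punchIn-last zero    = refl
toℕ-punchIn-last (suc k) = cong suc (toℕ-punchIn-last k)

A-minor₀ : ∀ n → det (minor (A (suc n)) zero) ≡ det (T n)
A-minor₀ n = det-cong _ (T n)
  (λ i k → trans (A-below-first-row n i (suc k)) (band-shift (toℕ i) (toℕ k)))

A-minor₁ : ∀ n → det (minor (A (suc (suc n))) (suc zero)) ≡ det (T∖1 (suc n))
A-minor₁ n = det-cong _ (T∖1 (suc n)) entries
  where
  entries : ∀ i k → minor (A (suc (suc n))) (suc zero) i k ≡ T∖1 (suc n) i k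
  entries i zero    = A-below-first-row (suc n) i zero
  entries i (suc k) = A-below-first-row (suc n) i (suc (suc k))

A-minor-last : ∀ n → det (minor (A (suc n)) (fromℕ n)) ≡ det (U n)
A-minor-last n = det-cong _ (U n) (λ i k →
  trans (A-below-first-row n i (punchIn (fromℕ n) k))
        (cong (band (suc (toℕ i))) (toℕ-punchIn-last k)))

sgn-2-periodic : ∀ n → sgn (suc (suc n)) ≡ sgn n
sgn-2-periodic n = neg-involutive (sgn n)

dA : ℕ → ℤ
dA = periodic (+ 1) (+ 2) (- + 1) (+ 0)

-- The value of the expansion of det A⁽³⁺ᵏ⁾; the sign (-1)^(2+k) is reduced using
-- its period 2, everything else is 4-periodic.
recurrence-A : ∀ k → dT k - dT∖1 k + sgn (suc (suc k)) * dT k ≡ dA (suc (suc (suc k)))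
recurrence-A = mod4-induction _ refl refl refl refl step
  where
  step : ∀ k → dT k - dT∖1 k + sgn (suc (suc k)) * dT k ≡ dA (suc (suc (suc k))) →
         dT k - dT∖1 k + sgn (suc (suc (suc (suc (suc (suc k)))))) * dT k ≡ dA (suc (suc (suc k)))
  step k e = trans (cong (λ s → dT k - dT∖1 k + s * dT k)
                         (trans (sgn-2-periodic (suc (suc (suc (suc k))))) (sgn-2-periodic (suc (suc k))))) e

det-A : ∀ k → det (A (suc (suc (suc k)))) ≡ dA (suc (suc (suc k)))
det-A k = begin
    det M
  ≡⟨ expand-row-corner M refl refl (A-first-row-middle k) (A-corner k) ⟩
    det (minor M zero) - det (minor M (suc zero)) + sgn (suc (suc k)) * det (minor M (fromℕ (suc (suc k))))
  ≡⟨ cong₂ _+_ (cong₂ _-_ (trans (A-minor₀ (suc (suc k))) (det-T k)) (trans (A-minor₁ (suc k)) (det-T∖1 k)))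
               (cong (sgn (suc (suc k)) *_) (trans (A-minor-last (suc (suc k))) (det-U k))) ⟩
    dT k - dT∖1 k + sgn (suc (suc k)) * dT k
  ≡⟨ recurrence-A k ⟩
    dA (suc (suc (suc k))) ∎
  where
  open ≡-Reasoning
  M : Matrix (suc (suc (suc k)))
  M = A (suc (suc (suc k)))

det-A-residue : ∀ n → 3 ≤ n → det (A n) ≡ dA (n % 4)
det-A-residue _ (s≤s (s≤s (s≤s {n = k} _))) =
  trans (det-A k) (periodic-mod (+ 1) (+ 2) (- + 1) (+ 0) (suc (suc (suc k))))

theorem1 : (n : ℕ) → 3 ≤ n →
    (n % 4 ≡ 0 → det (A n) ≡ + 1) ×
    (n % 4 ≡ 1 → det (A n) ≡ + 2) ×
    (n % 4 ≡ 2 → det (A n) ≡ - (+ 1)) ×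
    (n % 4 ≡ 3 → det (A n) ≡ + 0)
theorem1 n 3≤n = value-at , value-at , value-at , value-at
  where
  value-at : ∀ {r} → n % 4 ≡ r → det (A n) ≡ dA r
  value-at n%4≡r = trans (det-A-residue n 3≤n) (cong dA n%4≡r)
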